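{- Let $G$ be a finite group such that the subgroups $H\leq G$ maximizing $|H|\,|C_G(H)|$ are exactly $\{1\}$ and $G$. Let $\Gamma(G)\leq\operatorname{Sym}(G)$ be the group generated by all $\lambda_g$, $\rho_g$ ($g\in G$) and $\iota$. Then $\{\lambda(G),\rho(G)\}$ is the only (unordered) pair $\{U,V\}$ of subgroups of $\Gamma(G)$ such that $U$ and $V$ both act regularly on $G$ and commute elementwise with each other.
   Context: For $g\in G$, $\lambda_g\in\operatorname{Sym}(G)$ is $x\mapsto gx$, $\rho_g$ is $x\mapsto xg^{ -1}$, and $\iota$ is $x\mapsto x^{ -1}$; $\lambda(G)=\{\lambda_g\mid g\in G\}$, $\rho(G)=\{\rho_g\mid g\in G\}$. $C_G(H)$ is the centralizer of $H$ in $G$. A permutation group acts regularly if it acts transitively with trivial point stabilizers. -}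

module Defs where

open import Data.Nat using (ℕ; _*_; _≤_)
open import Data.Fin using (Fin)
open import Data.Fin.Properties using (all?; _≟_)
open import Data.Fin.Subset using (Subset; _∈_; ∣_∣; ⁅_⁆; ⊤)
open import Data.Fin.Subset.Properties using (_∈?_)
open import Data.Fin.Permutation using (Permutation′; permutation; _⟨$⟩ʳ_; _⟨$⟩ˡ_; id; flip; _∘ₚ_)
open import Data.Vec using (tabulate)
open import Data.Product using (Σ; ∃; _×_; _,_)
open import Data.Sum using (_⊎_)
open import Algebra.Structures using (IsGroup)
open import Relation.Nullary.Decidable using (⌊_⌋; _→-dec_)
open import Relation.Binary.PropositionalEquality using (_≡_; refl; sym; trans; cong)
open import Function.Bundles using (_⇔_)

-- A finite group of order n, realised on the carrier Fin n
-- (every finite group is isomorphic to one of this form).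
record FinGroup (n : ℕ) : Set where
  infixl 7 _∙_
  field
    _∙_     : Fin n → Fin n → Fin n
    ε       : Fin n
    _⁻¹     : Fin n → Fin n
    isGroup : IsGroup _≡_ _∙_ ε _⁻¹

module Notions {n : ℕ} (G : FinGroup n) where
  open FinGroup G using (_∙_; ε; _⁻¹; isGroup)
  open IsGroup isGroup using (assoc; identityˡ; identityʳ; inverseˡ; inverseʳ)

  record IsSubgroup (H : Subset n) : Set where
    field
      ε-closed : ε ∈ H
      ∙-closed : ∀ {x y} → x ∈ H → y ∈ H → x ∙ y ∈ H
      ⁻¹-closed : ∀ {x} → x ∈ H → x ⁻¹ ∈ H

  centralizer : Subset n → Subset n
  centralizer H = tabulate (λ x → ⌊ all? (λ h → (h ∈? H) →-dec ((x ∙ h) ≟ (h ∙ x))) ⌋)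

  score : Subset n → ℕ
  score H = ∣ H ∣ * ∣ centralizer H ∣

  IsMaximizer : Subset n → Set
  IsMaximizer H = IsSubgroup H × (∀ K → IsSubgroup K → score K ≤ score H)

  MaximizersTrivial : Set
  MaximizersTrivial = ∀ H → IsMaximizer H ⇔ (H ≡ ⁅ ε ⁆ ⊎ H ≡ ⊤)

  Sym : Set
  Sym = Permutation′ n

  _≈ₚ_ : Sym → Sym → Set
  σ ≈ₚ τ = ∀ x → σ ⟨$⟩ʳ x ≡ τ ⟨$⟩ʳ x

  private
    cancelL : ∀ g x → g ∙ ((g ⁻¹) ∙ x) ≡ x
    cancelL g x = trans (sym (assoc g (g ⁻¹) x)) (trans (cong (_∙ x) (inverseʳ g)) (identityˡ x))
    cancelL' : ∀ g x → (g ⁻¹) ∙ (g ∙ x) ≡ x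
    cancelL' g x = trans (sym (assoc (g ⁻¹) g x)) (trans (cong (_∙ x) (inverseˡ g)) (identityˡ x))
    cancelR : ∀ g x → (x ∙ (g ⁻¹)) ∙ g ≡ x
    cancelR g x = trans (assoc x (g ⁻¹) g) (trans (cong (x ∙_) (inverseˡ g)) (identityʳ x))
    cancelR' : ∀ g x → (x ∙ g) ∙ (g ⁻¹) ≡ x
    cancelR' g x = trans (assoc x g (g ⁻¹)) (trans (cong (x ∙_) (inverseʳ g)) (identityʳ x))
    invinv : ∀ x → (x ⁻¹) ⁻¹ ≡ x
    invinv x = trans (sym (identityʳ ((x ⁻¹) ⁻¹)))
               (trans (cong ((x ⁻¹) ⁻¹ ∙_) (sym (inverseˡ x)))
               (trans (sym (assoc ((x ⁻¹) ⁻¹) (x ⁻¹) x))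
               (trans (cong (_∙ x) (inverseˡ (x ⁻¹))) (identityˡ x))))

  lam : Fin n → Sym
  lam g = permutation (λ x → g ∙ x) (λ x → (g ⁻¹) ∙ x) (cancelL g) (cancelL' g)

  rho : Fin n → Sym
  rho g = permutation (λ x → x ∙ (g ⁻¹)) (λ x → x ∙ g) (cancelR' g) (cancelR g)

  iota : Sym
  iota = permutation _⁻¹ _⁻¹ invinv invinv

  data InΓ : Sym → Set where
    gen-λ : ∀ g → InΓ (lam g)
    gen-ρ : ∀ g → InΓ (rho g)
    gen-ι : InΓ iota
    one   : InΓ id
    comp  : ∀ {σ τ} → InΓ σ → InΓ τ → InΓ (σ ∘ₚ τ)
    inv   : ∀ {σ} → InΓ σ → InΓ (flip σ)
    resp  : ∀ {σ τ} → σ ≈ₚ τ → InΓ σ → InΓ τ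

  record IsPermSubgroup (U : Sym → Set) : Set where
    field
      resp-≈ : ∀ {σ τ} → σ ≈ₚ τ → U σ → U τ
      id-closed : U id
      ∘-closed : ∀ {σ τ} → U σ → U τ → U (σ ∘ₚ τ)
      flip-closed : ∀ {σ} → U σ → U (flip σ)

  record ActsRegularly (U : Sym → Set) : Set where
    field
      transitive : ∀ x y → ∃ λ σ → U σ × (σ ⟨$⟩ʳ x ≡ y)
      freeStab  : ∀ σ → U σ → ∀ x → σ ⟨$⟩ʳ x ≡ x → σ ≈ₚ id

  Commute : (U V : Sym → Set) → Set
  Commute U V = ∀ σ τ → U σ → V τ → ∀ x → σ ⟨$⟩ʳ (τ ⟨$⟩ʳ x) ≡ τ ⟨$⟩ʳ (σ ⟨$⟩ʳ x)

  record GoodPair (U V : Sym → Set) : Set where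
    field
      U-subgroup : IsPermSubgroup U
      V-subgroup : IsPermSubgroup V
      U⊆Γ : ∀ σ → U σ → InΓ σ
      V⊆Γ : ∀ σ → V σ → InΓ σ
      U-regular : ActsRegularly U
      V-regular : ActsRegularly V
      commute : Commute U V

  λG : Sym → Set
  λG σ = ∃ λ g → σ ≈ₚ lam g

  ρG : Sym → Set
  ρG σ = ∃ λ g → σ ≈ₚ rho g

  _≐_ : (U V : Sym → Set) → Set
  U ≐ V = ∀ σ → U σ ⇔ V σ

  SameAsLambdaRho : (U V : Sym → Set) → Set
  SameAsLambdaRho U V = (U ≐ λG × V ≐ ρG) ⊎ (U ≐ ρG × V ≐ λG)

-- Every element of Γ(G) is x ↦ a x b or x ↦ a x⁻¹ b, and since the hypothesis forces Z(G) = 1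
-- the parameters a, b are determined by the map. An element of the second kind in U forces G = 1;
-- otherwise, for each x ↦ a x b in U, both λ_a and ρ_b⁻¹ centralize V and hence lie in U. So
-- G = L R⁻¹ for the subgroups L = {a | λ_a ∈ U}, R = {a | ρ_a ∈ U}, and likewise G = L' R'⁻¹ for V
-- with L' ⊆ C_G(L), R' ⊆ C_G(R). Hence n² ≤ |L| |C_G(L)| · |R| |C_G(R)|, and as every score is at
-- most n = score {1}, both L and R are maximizers: each is {1} or G, and L = G gives U = λ(G),
-- V = ρ(G), while R = G gives the reverse.
module Submission where

open import Defs
open import Algebra.Bundles using (Group)
open import Data.Bool.Properties using (T-≡)
open import Data.Fin using (Fin)
open import Data.Fin.Permutation using (_⟨$⟩ʳ_; _⟨$⟩ˡ_; _∘ₚ_; flip; id; inverseˡ; inverseʳ)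
open import Data.Fin.Properties using (all?; _≟_; injective⇒≤; nonZeroIndex)
open import Data.Fin.Subset using (Subset; _∈_; _⊆_; _⊂_; ∣_∣; ⁅_⁆; ⊤; inside; outside)
open import Data.Fin.Subset.Properties
  using (_∈?_; ∈⊤; x∈⁅y⁆⇒x≡y; ∣⁅x⁆∣≡1; ∣⊤∣≡n; ∣p∣≤n; p⊆q⇒∣p∣≤∣q∣; p⊂q⇒∣p∣<∣q∣)
open import Data.List as List using (List; length; cartesianProductWith)
open import Data.List.Properties using (length-++; length-map)
open import Data.List.Membership.Propositional using () renaming (_∈_ to _∈ₗ_)
open import Data.List.Membership.Propositional.Properties using (∈-map⁺; ∈-cartesianProductWith⁺)
import Data.List.Relation.Unary.Any as Any
open import Data.List.Relation.Unary.Any.Properties using (lookup-index)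
open import Data.Nat using (ℕ; zero; suc; _+_; _≤_; _<_; _*_; _≤?_; z≤n)
open import Data.Nat.Properties as ℕ using (module ≤-Reasoning)
open import Data.Product using (∃; ∃₂; _×_; _,_; proj₁; proj₂)
open import Data.Sum as Sum using (_⊎_; inj₁; inj₂)
open import Data.Vec using ([]; _∷_; tabulate; here; there)
open import Data.Vec.Properties using (lookup∘tabulate; []=⇒lookup; lookup⇒[]=)
open import Function.Base using (_∘_)
open import Function.Bundles using (Equivalence; mk⇔)
open import Level using (0ℓ)
open import Relation.Nullary using (Dec; yes; no; ¬_; contradiction)
open import Relation.Nullary.Decidable using (⌊_⌋; map′; toWitness; fromWitness; _→-dec_)
open import Relation.Binary.PropositionalEquality
  using (_≡_; refl; sym; trans; cong; cong₂; subst; module ≡-Reasoning)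

decSubset : ∀ {m} {P : Fin m → Set} → (∀ x → Dec (P x)) → Subset m
decSubset P? = tabulate (λ x → ⌊ P? x ⌋)

∈-decSubset⁺ : ∀ {m} {P : Fin m → Set} (P? : ∀ x → Dec (P x)) {x} → P x → x ∈ decSubset P?
∈-decSubset⁺ P? {x} px =
  lookup⇒[]= x _ (trans (lookup∘tabulate _ x) (Equivalence.to T-≡ (fromWitness px)))

∈-decSubset⁻ : ∀ {m} {P : Fin m → Set} (P? : ∀ x → Dec (P x)) {x} → x ∈ decSubset P? → P x
∈-decSubset⁻ P? {x} x∈ =
  toWitness (Equivalence.from T-≡ (trans (sym (lookup∘tabulate _ x)) ([]=⇒lookup x∈)))

elements : ∀ {m} → Subset m → List (Fin m)
elements []            = List.[]
elements (inside ∷ p)  = Fin.zero List.∷ List.map Fin.suc (elements p)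
elements (outside ∷ p) = List.map Fin.suc (elements p)

length-elements : ∀ {m} (p : Subset m) → length (elements p) ≡ ∣ p ∣
length-elements []            = refl
length-elements (inside ∷ p)  = cong suc (trans (length-map Fin.suc (elements p)) (length-elements p))
length-elements (outside ∷ p) = trans (length-map Fin.suc (elements p)) (length-elements p)

∈-elements : ∀ {m} {p : Subset m} {x} → x ∈ p → x ∈ₗ elements p
∈-elements {p = inside ∷ p}  here        = Any.here refl
∈-elements {p = inside ∷ p}  (there x∈p) = Any.there (∈-map⁺ Fin.suc (∈-elements x∈p))
∈-elements {p = outside ∷ p} (there x∈p) = ∈-map⁺ Fin.suc (∈-elements x∈p)

length-cartesianProductWith : ∀ {A B C : Set} (f : A → B → C) xs ys →
  length (cartesianProductWith f xs ys) ≡ length xs * length ys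
length-cartesianProductWith f List.[]         ys = refl
length-cartesianProductWith f (x List.∷ xs) ys = begin
  length (List.map (f x) ys List.++ cartesianProductWith f xs ys)
    ≡⟨ length-++ (List.map (f x) ys) ⟩
  length (List.map (f x) ys) + length (cartesianProductWith f xs ys)
    ≡⟨ cong₂ _+_ (length-map (f x) ys) (length-cartesianProductWith f xs ys) ⟩
  length ys + length xs * length ys ∎
  where open ≡-Reasoning

covering⇒≤length : ∀ {m} (xs : List (Fin m)) → (∀ x → x ∈ₗ xs) → m ≤ length xs
covering⇒≤length xs cover = injective⇒≤ index-injective
  where
  index-injective : ∀ {x y} → Any.index (cover x) ≡ Any.index (cover y) → x ≡ y
  index-injective {x} {y} eq =
    trans (lookup-index (cover x)) (trans (cong (List.lookup xs) eq) (sym (lookup-index (cover y))))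

covered-by-product⇒≤∣p∣*∣q∣ : ∀ {m} (p q : Subset m) (f : Fin m → Fin m → Fin m) →
  (∀ z → ∃₂ λ x y → x ∈ p × y ∈ q × z ≡ f x y) → m ≤ ∣ p ∣ * ∣ q ∣
covered-by-product⇒≤∣p∣*∣q∣ p q f covered = subst (_ ≤_) length≡ (covering⇒≤length _ cover)
  where
  length≡ : length (cartesianProductWith f (elements p) (elements q)) ≡ ∣ p ∣ * ∣ q ∣
  length≡ = trans (length-cartesianProductWith f (elements p) (elements q))
                  (cong₂ _*_ (length-elements p) (length-elements q))
  cover : ∀ z → z ∈ₗ cartesianProductWith f (elements p) (elements q)
  cover z with covered z
  ... | x , y , x∈p , y∈q , refl = ∈-cartesianProductWith⁺ f (∈-elements x∈p) (∈-elements y∈q)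

∣p∣≤1⇒x≡y : ∀ {m} {p : Subset m} {x y} → ∣ p ∣ ≤ 1 → x ∈ p → y ∈ p → x ≡ y
∣p∣≤1⇒x≡y {p = p} {x} {y} ∣p∣≤1 x∈p y∈p with x ≟ y
... | yes x≡y = x≡y
... | no x≢y  = contradiction ∣p∣≤1 (ℕ.<⇒≱ (subst (_< ∣ p ∣) (∣⁅x⁆∣≡1 y) (p⊂q⇒∣p∣<∣q∣ ⁅y⁆⊂p)))
  where
  ⁅y⁆⊂p : ⁅ y ⁆ ⊂ p
  ⁅y⁆⊂p = (λ z∈⁅y⁆ → subst (_∈ p) (sym (x∈⁅y⁆⇒x≡y y z∈⁅y⁆)) y∈p) , x , x∈p , x≢y ∘ x∈⁅y⁆⇒x≡y y

∣⁅x⁆∣*∣p∣≤n : ∀ {n} (x : Fin n) (p : Subset n) → ∣ ⁅ x ⁆ ∣ * ∣ p ∣ ≤ n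
∣⁅x⁆∣*∣p∣≤n {n} x p = begin
  ∣ ⁅ x ⁆ ∣ * ∣ p ∣  ≡⟨ cong (_* ∣ p ∣) (∣⁅x⁆∣≡1 x) ⟩
  1 * ∣ p ∣          ≡⟨ ℕ.*-identityˡ ∣ p ∣ ⟩
  ∣ p ∣              ≤⟨ ∣p∣≤n p ⟩
  n                  ∎
  where open ≤-Reasoning

∣⊤∣*∣p∣≤n⇒x≡y : ∀ {n} {p : Subset n} {x y} → ∣ ⊤ {n} ∣ * ∣ p ∣ ≤ n → x ∈ p → y ∈ p → x ≡ y
∣⊤∣*∣p∣≤n⇒x≡y {n} {p} {x} ∣⊤∣*∣p∣≤n = ∣p∣≤1⇒x≡y (ℕ.*-cancelˡ-≤ n ⦃ nonZeroIndex x ⦄ (begin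
  n * ∣ p ∣          ≡⟨ cong (_* ∣ p ∣) (∣⊤∣≡n n) ⟨
  ∣ ⊤ {n} ∣ * ∣ p ∣  ≤⟨ ∣⊤∣*∣p∣≤n ⟩
  n                  ≡⟨ ℕ.*-identityʳ n ⟨
  n * 1              ∎))
  where open ≤-Reasoning

m*m≤n*o⇒o≤m⇒m≤n : ∀ m n o → m * m ≤ n * o → o ≤ m → m ≤ n
m*m≤n*o⇒o≤m⇒m≤n zero    n o _     _   = z≤n
m*m≤n*o⇒o≤m⇒m≤n m@(suc _) n o m*m≤n*o o≤m with m ≤? n
... | yes m≤n = m≤n
... | no  m≰n = contradiction m*m≤n*o (ℕ.<⇒≱ (begin-strict
  n * o ≤⟨ ℕ.*-monoʳ-≤ n o≤m ⟩
  n * m <⟨ ℕ.*-monoˡ-< m (ℕ.≰⇒> m≰n) ⟩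
  m * m ∎))
  where open ≤-Reasoning

module _ {n : ℕ} (G : FinGroup n) where
  open FinGroup G
  open Notions G

  group : Group 0ℓ 0ℓ
  group = record { isGroup = isGroup }

  open Group group using (assoc; identityˡ; identityʳ; monoid)
  open import Algebra.Properties.Group group
    using (⁻¹-involutive; ⁻¹-injective; ⁻¹-anti-homo-∙; ε⁻¹≈ε; ∙-cancelˡ; ∙-cancelʳ;
           \\-leftDividesˡ; \\-leftDividesʳ; //-rightDividesˡ; x≈y⇒x∙y⁻¹≈ε)
  open import Algebra.Solver.Monoid monoid using (solve; _⊜_; _⊕_)
  open ≡-Reasoning

  ∙-regroup : ∀ a b c d x → c ∙ (a ∙ x ∙ b) ∙ d ≡ c ∙ a ∙ x ∙ (b ∙ d)
  ∙-regroup = solve 5 (λ a b c d x → (c ⊕ ((a ⊕ x) ⊕ b)) ⊕ d ⊜ ((c ⊕ a) ⊕ x) ⊕ (b ⊕ d)) refl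

  ⁻¹-anti-homo-∙∙ : ∀ a x b → (a ∙ x ∙ b) ⁻¹ ≡ b ⁻¹ ∙ x ⁻¹ ∙ a ⁻¹
  ⁻¹-anti-homo-∙∙ a x b = begin
    (a ∙ x ∙ b) ⁻¹          ≡⟨ ⁻¹-anti-homo-∙ (a ∙ x) b ⟩
    b ⁻¹ ∙ (a ∙ x) ⁻¹        ≡⟨ cong (b ⁻¹ ∙_) (⁻¹-anti-homo-∙ a x) ⟩
    b ⁻¹ ∙ (x ⁻¹ ∙ a ⁻¹)     ≡⟨ assoc (b ⁻¹) (x ⁻¹) (a ⁻¹) ⟨
    b ⁻¹ ∙ x ⁻¹ ∙ a ⁻¹       ∎

  cancel-sandwich : ∀ a b x → a ∙ (a ⁻¹ ∙ x ∙ b ⁻¹) ∙ b ≡ x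
  cancel-sandwich a b x = begin
    a ∙ (a ⁻¹ ∙ x ∙ b ⁻¹) ∙ b     ≡⟨ solve 5 (λ a a' x b' b →
                                       (a ⊕ ((a' ⊕ x) ⊕ b')) ⊕ b ⊜ a ⊕ (a' ⊕ ((x ⊕ b') ⊕ b)))
                                       refl a (a ⁻¹) x (b ⁻¹) b ⟩
    a ∙ (a ⁻¹ ∙ (x ∙ b ⁻¹ ∙ b))   ≡⟨ \\-leftDividesˡ a (x ∙ b ⁻¹ ∙ b) ⟩
    x ∙ b ⁻¹ ∙ b                  ≡⟨ //-rightDividesˡ b x ⟩
    x                             ∎

  ⁻¹-commute⇒commute : ∀ {a b} → a ⁻¹ ∙ b ⁻¹ ≡ b ⁻¹ ∙ a ⁻¹ → a ∙ b ≡ b ∙ a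
  ⁻¹-commute⇒commute {a} {b} eq = ⁻¹-injective (begin
    (a ∙ b) ⁻¹    ≡⟨ ⁻¹-anti-homo-∙ a b ⟩
    b ⁻¹ ∙ a ⁻¹   ≡⟨ eq ⟨
    a ⁻¹ ∙ b ⁻¹   ≡⟨ ⁻¹-anti-homo-∙ b a ⟨
    (b ∙ a) ⁻¹    ∎)

  ε-central : ∀ x → ε ∙ x ≡ x ∙ ε
  ε-central x = trans (identityˡ x) (sym (identityʳ x))

  ∈-centralizer⁺ : ∀ {H x} → (∀ h → h ∈ H → x ∙ h ≡ h ∙ x) → x ∈ centralizer H
  ∈-centralizer⁺ {H} = ∈-decSubset⁺ (λ x → all? (λ h → (h ∈? H) →-dec ((x ∙ h) ≟ (h ∙ x))))

  ⊤-isSubgroup : IsSubgroup ⊤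
  ⊤-isSubgroup = record { ε-closed = ∈⊤ ; ∙-closed = λ _ _ → ∈⊤ ; ⁻¹-closed = λ _ → ∈⊤ }

  ∘ₚ-apply : ∀ σ τ {f g : Fin n → Fin n} → (∀ x → σ ⟨$⟩ʳ x ≡ f x) → (∀ x → τ ⟨$⟩ʳ x ≡ g x) →
             ∀ x → (σ ∘ₚ τ) ⟨$⟩ʳ x ≡ g (f x)
  ∘ₚ-apply σ τ {g = g} σ≗f τ≗g x = trans (τ≗g _) (cong g (σ≗f x))

  flip-apply : ∀ σ {f : Fin n → Fin n} → (∀ x → σ ⟨$⟩ʳ f x ≡ x) → ∀ x → flip σ ⟨$⟩ʳ x ≡ f x
  flip-apply σ σ∘f≗id x = trans (cong (σ ⟨$⟩ˡ_) (sym (σ∘f≗id x))) (inverseˡ σ)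

  -- _∘ₚ_ is diagrammatic, (σ ∘ₚ τ) x = τ (σ x), so ∙-homo is the usual homomorphism law.
  record IsHomomorphism (f : Fin n → Sym) : Set where
    field
      ε-homo  : f ε ≈ₚ id
      ∙-homo  : ∀ a b → f (a ∙ b) ≈ₚ (f b ∘ₚ f a)
      ⁻¹-homo : ∀ a → f (a ⁻¹) ≈ₚ flip (f a)

  lam-isHomomorphism : IsHomomorphism lam
  lam-isHomomorphism = record
    { ε-homo  = identityˡ
    ; ∙-homo  = assoc
    ; ⁻¹-homo = λ _ _ → refl
    }

  rho-⁻¹ : ∀ a x → rho (a ⁻¹) ⟨$⟩ʳ x ≡ x ∙ a
  rho-⁻¹ a x = cong (x ∙_) (⁻¹-involutive a)

  rho-isHomomorphism : IsHomomorphism rho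
  rho-isHomomorphism = record
    { ε-homo  = λ x → trans (cong (x ∙_) ε⁻¹≈ε) (identityʳ x)
    ; ∙-homo  = λ a b x → trans (cong (x ∙_) (⁻¹-anti-homo-∙ a b)) (sym (assoc x (b ⁻¹) (a ⁻¹)))
    ; ⁻¹-homo = rho-⁻¹
    }

  Image : (Fin n → Sym) → Sym → Set
  Image f σ = ∃ λ g → σ ≈ₚ f g

  image-isPermSubgroup : ∀ {f} → IsHomomorphism f → IsPermSubgroup (Image f)
  image-isPermSubgroup {f} f-homo = record
    { resp-≈      = λ { σ≈τ (g , σ≈fg) → g , λ x → trans (sym (σ≈τ x)) (σ≈fg x) }
    ; id-closed   = ε , λ x → sym (ε-homo x)
    ; ∘-closed    = λ { {σ} {τ} (g , σ≈fg) (h , τ≈fh) → h ∙ g , λ x →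
                        trans (∘ₚ-apply σ τ σ≈fg τ≈fh x) (sym (∙-homo h g x)) }
    ; flip-closed = λ { {σ} (g , σ≈fg) → g ⁻¹ , λ x →
                        trans (flip-apply σ (λ y → trans (σ≈fg _) (inverseʳ (f g))) x) (sym (⁻¹-homo g x)) }
    }
    where open IsHomomorphism f-homo

  module RegularSubgroup {W : Sym → Set} (W-subgroup : IsPermSubgroup W) (W-regular : ActsRegularly W) where
    open IsPermSubgroup W-subgroup public
    open ActsRegularly W-regular public

    agreeAt⇒≈ₚ : ∀ {π π' x} → W π → W π' → π ⟨$⟩ʳ x ≡ π' ⟨$⟩ʳ x → π ≈ₚ π'
    agreeAt⇒≈ₚ {π} {π'} {x} wπ wπ' eq y = begin
      π ⟨$⟩ʳ y                      ≡⟨ inverseʳ π' ⟨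
      π' ⟨$⟩ʳ (π' ⟨$⟩ˡ (π ⟨$⟩ʳ y))  ≡⟨ cong (π' ⟨$⟩ʳ_) (freeStab _ (∘-closed wπ (flip-closed wπ')) x fixes-x y) ⟩
      π' ⟨$⟩ʳ y                     ∎
      where
      fixes-x : π' ⟨$⟩ˡ (π ⟨$⟩ʳ x) ≡ x
      fixes-x = trans (cong (π' ⟨$⟩ˡ_) eq) (inverseˡ π')

    elementTo : Fin n → Sym
    elementTo y = proj₁ (transitive ε y)

    elementTo-∈ : ∀ y → W (elementTo y)
    elementTo-∈ y = proj₁ (proj₂ (transitive ε y))

    elementTo-ε : ∀ y → elementTo y ⟨$⟩ʳ ε ≡ y
    elementTo-ε y = proj₂ (proj₂ (transitive ε y))

    W? : ∀ π → Dec (W π)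
    W? π = map′ (λ agree → resp-≈ agree (elementTo-∈ _))
                (λ wπ → agreeAt⇒≈ₚ (elementTo-∈ _) wπ (elementTo-ε _))
                (all? λ x → elementTo (π ⟨$⟩ʳ ε) ⟨$⟩ʳ x ≟ π ⟨$⟩ʳ x)

    preimage : (Fin n → Sym) → Subset n
    preimage f = decSubset (λ a → W? (f a))

    ∈-preimage⁺ : ∀ {f a} → W (f a) → a ∈ preimage f
    ∈-preimage⁺ {f} = ∈-decSubset⁺ (λ a → W? (f a))

    ∈-preimage⁻ : ∀ {f a} → a ∈ preimage f → W (f a)
    ∈-preimage⁻ {f} = ∈-decSubset⁻ (λ a → W? (f a))

    preimage-isSubgroup : ∀ {f} → IsHomomorphism f → IsSubgroup (preimage f)
    preimage-isSubgroup f-homo = record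
      { ε-closed  = ∈-preimage⁺ (resp-≈ (sym ∘ ε-homo) id-closed)
      ; ∙-closed  = λ {a} {b} a∈ b∈ →
          ∈-preimage⁺ (resp-≈ (sym ∘ ∙-homo a b) (∘-closed (∈-preimage⁻ b∈) (∈-preimage⁻ a∈)))
      ; ⁻¹-closed = λ {a} a∈ → ∈-preimage⁺ (resp-≈ (sym ∘ ⁻¹-homo a) (flip-closed (∈-preimage⁻ a∈)))
      }
      where open IsHomomorphism f-homo

    lamPart rhoPart : Subset n
    lamPart = preimage lam
    rhoPart = preimage rho

    lamPart-isSubgroup : IsSubgroup lamPart
    lamPart-isSubgroup = preimage-isSubgroup lam-isHomomorphism

    rhoPart-isSubgroup : IsSubgroup rhoPart
    rhoPart-isSubgroup = preimage-isSubgroup rho-isHomomorphism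

  Trivial : Set
  Trivial = ∀ g → g ≡ ε

  trivial⇒≈ₚ : Trivial → ∀ σ τ → σ ≈ₚ τ
  trivial⇒≈ₚ trivial σ τ x = trans (trivial _) (sym (trivial _))

  trivial⇒≐Image : Trivial → ∀ {W} → IsPermSubgroup W → ∀ f → W ≐ Image f
  trivial⇒≐Image trivial W-subgroup f σ =
    mk⇔ (λ _ → ε , trivial⇒≈ₚ trivial σ (f ε)) (λ _ → resp-≈ (trivial⇒≈ₚ trivial id σ) id-closed)
    where open IsPermSubgroup W-subgroup

  trivial⇒sameAsLambdaRho : Trivial → ∀ {U V} → IsPermSubgroup U → IsPermSubgroup V → SameAsLambdaRho U V
  trivial⇒sameAsLambdaRho trivial U-subgroup V-subgroup =
    inj₁ (trivial⇒≐Image trivial U-subgroup lam , trivial⇒≐Image trivial V-subgroup rho)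

  record BiTranslation (σ : Sym) : Set where
    constructor biTranslation
    field
      left right : Fin n
      apply      : ∀ x → σ ⟨$⟩ʳ x ≡ left ∙ x ∙ right

  record InvertedBiTranslation (σ : Sym) : Set where
    constructor invertedBiTranslation
    field
      left right : Fin n
      apply      : ∀ x → σ ⟨$⟩ʳ x ≡ left ∙ x ⁻¹ ∙ right

  biTranslation-∘ₚ : ∀ {σ τ} → BiTranslation σ → BiTranslation τ → BiTranslation (σ ∘ₚ τ)
  biTranslation-∘ₚ {σ} {τ} (biTranslation a b σ≗) (biTranslation c d τ≗) =
    biTranslation (c ∙ a) (b ∙ d) λ x → trans (∘ₚ-apply σ τ σ≗ τ≗ x) (∙-regroup a b c d x)

  biTranslation-∘ₚ-inverted : ∀ {σ τ} → BiTranslation σ → InvertedBiTranslation τ →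
                              InvertedBiTranslation (σ ∘ₚ τ)
  biTranslation-∘ₚ-inverted {σ} {τ} (biTranslation a b σ≗) (invertedBiTranslation c d τ≗) =
    invertedBiTranslation (c ∙ b ⁻¹) (a ⁻¹ ∙ d) λ x → begin
      (σ ∘ₚ τ) ⟨$⟩ʳ x                ≡⟨ ∘ₚ-apply σ τ σ≗ τ≗ x ⟩
      c ∙ (a ∙ x ∙ b) ⁻¹ ∙ d         ≡⟨ cong (λ z → c ∙ z ∙ d) (⁻¹-anti-homo-∙∙ a x b) ⟩
      c ∙ (b ⁻¹ ∙ x ⁻¹ ∙ a ⁻¹) ∙ d   ≡⟨ ∙-regroup (b ⁻¹) (a ⁻¹) c d (x ⁻¹) ⟩
      c ∙ b ⁻¹ ∙ x ⁻¹ ∙ (a ⁻¹ ∙ d)   ∎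

  inverted-∘ₚ-biTranslation : ∀ {σ τ} → InvertedBiTranslation σ → BiTranslation τ →
                              InvertedBiTranslation (σ ∘ₚ τ)
  inverted-∘ₚ-biTranslation {σ} {τ} (invertedBiTranslation a b σ≗) (biTranslation c d τ≗) =
    invertedBiTranslation (c ∙ a) (b ∙ d) λ x → trans (∘ₚ-apply σ τ σ≗ τ≗ x) (∙-regroup a b c d (x ⁻¹))

  inverted-∘ₚ : ∀ {σ τ} → InvertedBiTranslation σ → InvertedBiTranslation τ → BiTranslation (σ ∘ₚ τ)
  inverted-∘ₚ {σ} {τ} (invertedBiTranslation a b σ≗) (invertedBiTranslation c d τ≗) =
    biTranslation (c ∙ b ⁻¹) (a ⁻¹ ∙ d) λ x → begin
      (σ ∘ₚ τ) ⟨$⟩ʳ x                   ≡⟨ ∘ₚ-apply σ τ σ≗ τ≗ x ⟩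
      c ∙ (a ∙ x ⁻¹ ∙ b) ⁻¹ ∙ d         ≡⟨ cong (λ z → c ∙ z ∙ d) (⁻¹-anti-homo-∙∙ a (x ⁻¹) b) ⟩
      c ∙ (b ⁻¹ ∙ x ⁻¹ ⁻¹ ∙ a ⁻¹) ∙ d   ≡⟨ cong (λ z → c ∙ (b ⁻¹ ∙ z ∙ a ⁻¹) ∙ d) (⁻¹-involutive x) ⟩
      c ∙ (b ⁻¹ ∙ x ∙ a ⁻¹) ∙ d         ≡⟨ ∙-regroup (b ⁻¹) (a ⁻¹) c d x ⟩
      c ∙ b ⁻¹ ∙ x ∙ (a ⁻¹ ∙ d)         ∎

  biTranslation-flip : ∀ {σ} → BiTranslation σ → BiTranslation (flip σ)
  biTranslation-flip {σ} (biTranslation a b σ≗) =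
    biTranslation (a ⁻¹) (b ⁻¹) (flip-apply σ λ x → trans (σ≗ _) (cancel-sandwich a b x))

  inverted-flip : ∀ {σ} → InvertedBiTranslation σ → InvertedBiTranslation (flip σ)
  inverted-flip {σ} (invertedBiTranslation a b σ≗) = invertedBiTranslation b a (flip-apply σ λ x → begin
    σ ⟨$⟩ʳ (b ∙ x ⁻¹ ∙ a)               ≡⟨ σ≗ _ ⟩
    a ∙ (b ∙ x ⁻¹ ∙ a) ⁻¹ ∙ b           ≡⟨ cong (λ z → a ∙ z ∙ b) (⁻¹-anti-homo-∙∙ b (x ⁻¹) a) ⟩
    a ∙ (a ⁻¹ ∙ x ⁻¹ ⁻¹ ∙ b ⁻¹) ∙ b     ≡⟨ cong (λ z → a ∙ (a ⁻¹ ∙ z ∙ b ⁻¹) ∙ b) (⁻¹-involutive x) ⟩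
    a ∙ (a ⁻¹ ∙ x ∙ b ⁻¹) ∙ b           ≡⟨ cancel-sandwich a b x ⟩
    x                                   ∎)

  biTranslation-resp : ∀ {σ τ} → σ ≈ₚ τ → BiTranslation σ → BiTranslation τ
  biTranslation-resp σ≈τ (biTranslation a b σ≗) = biTranslation a b λ x → trans (sym (σ≈τ x)) (σ≗ x)

  inverted-resp : ∀ {σ τ} → σ ≈ₚ τ → InvertedBiTranslation σ → InvertedBiTranslation τ
  inverted-resp σ≈τ (invertedBiTranslation a b σ≗) = invertedBiTranslation a b λ x → trans (sym (σ≈τ x)) (σ≗ x)

  Γ-normalForm : ∀ {σ} → InΓ σ → BiTranslation σ ⊎ InvertedBiTranslation σ
  Γ-normalForm (gen-λ g) = inj₁ (biTranslation g ε λ x → sym (identityʳ (g ∙ x)))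
  Γ-normalForm (gen-ρ g) = inj₁ (biTranslation ε (g ⁻¹) λ x → cong (_∙ g ⁻¹) (sym (identityˡ x)))
  Γ-normalForm gen-ι     = inj₂ (invertedBiTranslation ε ε λ x → sym (trans (identityʳ _) (identityˡ _)))
  Γ-normalForm one       = inj₁ (biTranslation ε ε λ x → sym (trans (identityʳ _) (identityˡ _)))
  Γ-normalForm (comp p q) with Γ-normalForm p | Γ-normalForm q
  ... | inj₁ s | inj₁ t = inj₁ (biTranslation-∘ₚ s t)
  ... | inj₁ s | inj₂ t = inj₂ (biTranslation-∘ₚ-inverted s t)
  ... | inj₂ s | inj₁ t = inj₂ (inverted-∘ₚ-biTranslation s t)
  ... | inj₂ s | inj₂ t = inj₁ (inverted-∘ₚ s t)
  Γ-normalForm (inv p)      = Sum.map biTranslation-flip inverted-flip (Γ-normalForm p)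
  Γ-normalForm (resp σ≈τ p) = Sum.map (biTranslation-resp σ≈τ) (inverted-resp σ≈τ) (Γ-normalForm p)

  λG-regular : ActsRegularly λG
  λG-regular = record
    { transitive = λ x y → lam (y ∙ x ⁻¹) , (y ∙ x ⁻¹ , λ _ → refl) , //-rightDividesˡ x y
    ; freeStab   = λ { σ (g , σ≈) x σx≡x y →
        let g≡ε = ∙-cancelʳ x g ε (trans (sym (σ≈ x)) (trans σx≡x (sym (identityˡ x))))
        in trans (σ≈ y) (trans (cong (_∙ y) g≡ε) (identityˡ y)) }
    }

  ρG-regular : ActsRegularly ρG
  ρG-regular = record
    { transitive = λ x y → rho ((x ⁻¹ ∙ y) ⁻¹) , ((x ⁻¹ ∙ y) ⁻¹ , λ _ → refl) ,
                           trans (rho-⁻¹ (x ⁻¹ ∙ y) x) (\\-leftDividesˡ x y)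
    ; freeStab   = λ { σ (g , σ≈) x σx≡x y →
        let g⁻¹≡ε = ∙-cancelˡ x (g ⁻¹) ε (trans (sym (σ≈ x)) (trans σx≡x (sym (identityʳ x))))
        in trans (σ≈ y) (trans (cong (y ∙_) g⁻¹≡ε) (identityʳ y)) }
    }

  λG-ρG-commute : Commute λG ρG
  λG-ρG-commute σ τ (g , σ≈) (h , τ≈) x = begin
    σ ⟨$⟩ʳ (τ ⟨$⟩ʳ x)   ≡⟨ σ≈ _ ⟩
    g ∙ (τ ⟨$⟩ʳ x)       ≡⟨ cong (g ∙_) (τ≈ x) ⟩
    g ∙ (x ∙ h ⁻¹)      ≡⟨ assoc g x (h ⁻¹) ⟨
    g ∙ x ∙ h ⁻¹        ≡⟨ cong (_∙ h ⁻¹) (σ≈ x) ⟨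
    (σ ⟨$⟩ʳ x) ∙ h ⁻¹    ≡⟨ τ≈ _ ⟨
    τ ⟨$⟩ʳ (σ ⟨$⟩ʳ x)   ∎

  λG-ρG-goodPair : GoodPair λG ρG
  λG-ρG-goodPair = record
    { U-subgroup = image-isPermSubgroup lam-isHomomorphism
    ; V-subgroup = image-isPermSubgroup rho-isHomomorphism
    ; U⊆Γ        = λ { σ (g , σ≈) → resp (sym ∘ σ≈) (gen-λ g) }
    ; V⊆Γ        = λ { σ (g , σ≈) → resp (sym ∘ σ≈) (gen-ρ g) }
    ; U-regular  = λG-regular
    ; V-regular  = ρG-regular
    ; commute    = λG-ρG-commute
    }

  swap : ∀ {U V} → GoodPair U V → GoodPair V U
  swap gp = record
    { U-subgroup = V-subgroup
    ; V-subgroup = U-subgroup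
    ; U⊆Γ        = V⊆Γ
    ; V⊆Γ        = U⊆Γ
    ; U-regular  = V-regular
    ; V-regular  = U-regular
    ; commute    = λ σ τ vσ uτ x → sym (commute τ σ uτ vσ x)
    }
    where open GoodPair gp

  module GoodPairProperties {U V} (gp : GoodPair U V) where
    open GoodPair gp
    module U = RegularSubgroup U-subgroup U-regular
    module V = RegularSubgroup V-subgroup V-regular

    centralizes-V⇒∈U : ∀ π → (∀ τ → V τ → ∀ x → π ⟨$⟩ʳ (τ ⟨$⟩ʳ x) ≡ τ ⟨$⟩ʳ (π ⟨$⟩ʳ x)) → U π
    centralizes-V⇒∈U π π-comm = U.resp-≈ u≈π (U.elementTo-∈ _)
      where
      u : Sym
      u = U.elementTo (π ⟨$⟩ʳ ε)
      u≈π : u ≈ₚ π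
      u≈π x = begin
        u ⟨$⟩ʳ x               ≡⟨ cong (u ⟨$⟩ʳ_) (V.elementTo-ε x) ⟨
        u ⟨$⟩ʳ (t ⟨$⟩ʳ ε)      ≡⟨ commute u t (U.elementTo-∈ _) (V.elementTo-∈ x) ε ⟩
        t ⟨$⟩ʳ (u ⟨$⟩ʳ ε)      ≡⟨ cong (t ⟨$⟩ʳ_) (U.elementTo-ε _) ⟩
        t ⟨$⟩ʳ (π ⟨$⟩ʳ ε)      ≡⟨ π-comm t (V.elementTo-∈ x) ε ⟨
        π ⟨$⟩ʳ (t ⟨$⟩ʳ ε)      ≡⟨ cong (π ⟨$⟩ʳ_) (V.elementTo-ε x) ⟩
        π ⟨$⟩ʳ x               ∎
        where
        t : Sym
        t = V.elementTo x

    V-lamPart⊆centralizer : V.lamPart ⊆ centralizer U.lamPart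
    V-lamPart⊆centralizer {c} c∈ = ∈-centralizer⁺ λ h h∈ → begin
      c ∙ h               ≡⟨ cong (c ∙_) (identityʳ h) ⟨
      c ∙ (h ∙ ε)         ≡⟨ commute (lam h) (lam c) (U.∈-preimage⁻ h∈) (V.∈-preimage⁻ c∈) ε ⟨
      h ∙ (c ∙ ε)         ≡⟨ cong (h ∙_) (identityʳ c) ⟩
      h ∙ c               ∎

    V-rhoPart⊆centralizer : V.rhoPart ⊆ centralizer U.rhoPart
    V-rhoPart⊆centralizer {c} c∈ = ∈-centralizer⁺ λ h h∈ → ⁻¹-commute⇒commute (begin
      c ⁻¹ ∙ h ⁻¹         ≡⟨ cong (_∙ h ⁻¹) (identityˡ (c ⁻¹)) ⟨
      ε ∙ c ⁻¹ ∙ h ⁻¹     ≡⟨ commute (rho h) (rho c) (U.∈-preimage⁻ h∈) (V.∈-preimage⁻ c∈) ε ⟩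
      ε ∙ h ⁻¹ ∙ c ⁻¹     ≡⟨ cong (_∙ c ⁻¹) (identityˡ (h ⁻¹)) ⟩
      h ⁻¹ ∙ c ⁻¹         ∎)

    lam⊆U⇒≐ : (∀ a → U (lam a)) → U ≐ λG × V ≐ ρG
    lam⊆U⇒≐ lam∈U = U≐λG , V≐ρG
      where
      V-right : ∀ {τ} → V τ → ∀ x → τ ⟨$⟩ʳ x ≡ x ∙ (τ ⟨$⟩ʳ ε)
      V-right {τ} vτ x = trans (cong (τ ⟨$⟩ʳ_) (sym (identityʳ x))) (sym (commute (lam x) τ (lam∈U x) vτ ε))

      U≐λG : U ≐ λG
      U≐λG σ = mk⇔ (λ uσ → σ ⟨$⟩ʳ ε , U.agreeAt⇒≈ₚ uσ (lam∈U _) (sym (identityʳ _)))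
                   (λ { (g , σ≈) → U.resp-≈ (sym ∘ σ≈) (lam∈U g) })

      V≐ρG : V ≐ ρG
      V≐ρG τ = mk⇔ (λ vτ → (τ ⟨$⟩ʳ ε) ⁻¹ , λ x → trans (V-right vτ x) (sym (rho-⁻¹ _ x)))
                   (λ { (g , τ≈) → V.resp-≈ (λ x → trans (V-right (V.elementTo-∈ _) x)
                                                 (trans (cong (x ∙_) (V.elementTo-ε _)) (sym (τ≈ x))))
                                            (V.elementTo-∈ (g ⁻¹)) })

    rho⊆U⇒≐ : (∀ a → U (rho a)) → U ≐ ρG × V ≐ λG
    rho⊆U⇒≐ rho∈U = U≐ρG , V≐λG
      where
      V-left : ∀ {τ} → V τ → ∀ x → τ ⟨$⟩ʳ x ≡ (τ ⟨$⟩ʳ ε) ∙ x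
      V-left {τ} vτ x = begin
        τ ⟨$⟩ʳ x                           ≡⟨ cong (τ ⟨$⟩ʳ_) (trans (rho-⁻¹ x ε) (identityˡ x)) ⟨
        τ ⟨$⟩ʳ (rho (x ⁻¹) ⟨$⟩ʳ ε)         ≡⟨ commute (rho (x ⁻¹)) τ (rho∈U _) vτ ε ⟨
        rho (x ⁻¹) ⟨$⟩ʳ (τ ⟨$⟩ʳ ε)         ≡⟨ rho-⁻¹ x _ ⟩
        (τ ⟨$⟩ʳ ε) ∙ x                      ∎

      U≐ρG : U ≐ ρG
      U≐ρG σ = mk⇔ (λ uσ → (σ ⟨$⟩ʳ ε) ⁻¹ , U.agreeAt⇒≈ₚ uσ (rho∈U _) (sym (trans (rho-⁻¹ _ ε) (identityˡ _))))
                   (λ { (g , σ≈) → U.resp-≈ (sym ∘ σ≈) (rho∈U g) })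

      V≐λG : V ≐ λG
      V≐λG τ = mk⇔ (λ vτ → τ ⟨$⟩ʳ ε , V-left vτ)
                   (λ { (g , τ≈) → V.resp-≈ (λ x → trans (V-left (V.elementTo-∈ _) x)
                                                 (trans (cong (_∙ x) (V.elementTo-ε _)) (sym (τ≈ x))))
                                            (V.elementTo-∈ g) })

  module _ (maximizersTrivial : MaximizersTrivial) where

    score≤n : ∀ {K} → IsSubgroup K → score K ≤ n
    score≤n {K} K-subgroup =
      ℕ.≤-trans (proj₂ (Equivalence.from (maximizersTrivial ⁅ ε ⁆) (inj₁ refl)) K K-subgroup)
                (∣⁅x⁆∣*∣p∣≤n ε (centralizer ⁅ ε ⁆))

    n≤score⇒trivial⊎total : ∀ {H} → IsSubgroup H → n ≤ score H → H ≡ ⁅ ε ⁆ ⊎ H ≡ ⊤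
    n≤score⇒trivial⊎total {H} H-subgroup n≤score =
      Equivalence.to (maximizersTrivial H) (H-subgroup , λ K K-subgroup → ℕ.≤-trans (score≤n K-subgroup) n≤score)

    central⇒ε : ∀ {z} → (∀ x → z ∙ x ≡ x ∙ z) → z ≡ ε
    central⇒ε z-central = ∣⊤∣*∣p∣≤n⇒x≡y (score≤n ⊤-isSubgroup)
      (∈-centralizer⁺ λ x _ → z-central x) (∈-centralizer⁺ λ x _ → ε-central x)

    -- k = a'⁻¹ a satisfies k x b = x b' for all x; at x = ε this reads k b = b', so k is central.
    biTranslation-unique : ∀ {a b a' b'} → (∀ x → a ∙ x ∙ b ≡ a' ∙ x ∙ b') → a ≡ a' × b ≡ b'
    biTranslation-unique {a} {b} {a'} {b'} same = a≡a' , b≡b'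
      where
      k : Fin n
      k = a' ⁻¹ ∙ a
      k∙x∙b≡x∙b' : ∀ x → k ∙ x ∙ b ≡ x ∙ b'
      k∙x∙b≡x∙b' x = begin
        a' ⁻¹ ∙ a ∙ x ∙ b        ≡⟨ solve 4 (λ a'' a x b → ((a'' ⊕ a) ⊕ x) ⊕ b ⊜ a'' ⊕ ((a ⊕ x) ⊕ b))
                                            refl (a' ⁻¹) a x b ⟩
        a' ⁻¹ ∙ (a ∙ x ∙ b)      ≡⟨ cong (a' ⁻¹ ∙_) (same x) ⟩
        a' ⁻¹ ∙ (a' ∙ x ∙ b')    ≡⟨ cong (a' ⁻¹ ∙_) (assoc a' x b') ⟩
        a' ⁻¹ ∙ (a' ∙ (x ∙ b'))  ≡⟨ \\-leftDividesʳ a' (x ∙ b') ⟩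
        x ∙ b'                   ∎
      k∙b≡b' : k ∙ b ≡ b'
      k∙b≡b' = trans (cong (_∙ b) (sym (identityʳ k))) (trans (k∙x∙b≡x∙b' ε) (identityˡ b'))
      k≡ε : k ≡ ε
      k≡ε = central⇒ε λ x → ∙-cancelʳ b (k ∙ x) (x ∙ k)
        (trans (k∙x∙b≡x∙b' x) (trans (cong (x ∙_) (sym k∙b≡b')) (sym (assoc x k b))))
      a≡a' : a ≡ a'
      a≡a' = trans (sym (\\-leftDividesˡ a' a)) (trans (cong (a' ∙_) k≡ε) (identityʳ a'))
      b≡b' : b ≡ b'
      b≡b' = trans (sym (identityˡ b)) (trans (cong (_∙ b) (sym k≡ε)) k∙b≡b')

    invertedBiTranslation-unique : ∀ {a b a' b'} → (∀ x → a ∙ x ⁻¹ ∙ b ≡ a' ∙ x ⁻¹ ∙ b') → a ≡ a' × b ≡ b'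
    invertedBiTranslation-unique {a} {b} {a'} {b'} same = biTranslation-unique λ y →
      subst (λ z → a ∙ z ∙ b ≡ a' ∙ z ∙ b') (⁻¹-involutive y) (same (y ⁻¹))

    module _ {U V} (gp : GoodPair U V) where
      open GoodPair gp
      open GoodPairProperties gp

      -- If σ x = a x⁻¹ b lies in U and τ x = c x d in V, commutation forces a d⁻¹ = c a, i.e. τ a = a.
      inverted∈U⇒biTranslation∈V≈id : ∀ {σ τ} → U σ → InvertedBiTranslation σ → V τ → BiTranslation τ → τ ≈ₚ id
      inverted∈U⇒biTranslation∈V≈id {σ} {τ} uσ s vτ t@(biTranslation c d τ≗) = V.freeStab τ vτ a τa≡a
        where
        open InvertedBiTranslation s using () renaming (left to a)
        a∙d⁻¹≡c∙a : a ∙ d ⁻¹ ≡ c ∙ a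
        a∙d⁻¹≡c∙a = proj₁ (invertedBiTranslation-unique λ x →
          trans (sym (InvertedBiTranslation.apply (biTranslation-∘ₚ-inverted t s) x))
                (trans (commute σ τ uσ vτ x) (InvertedBiTranslation.apply (inverted-∘ₚ-biTranslation s t) x)))
        τa≡a : τ ⟨$⟩ʳ a ≡ a
        τa≡a = trans (τ≗ a) (trans (cong (_∙ d) (sym a∙d⁻¹≡c∙a)) (//-rightDividesˡ d a))

      -- V then contains no bi-translation but id, while the quotient of two inverted elements of V is
      -- a bi-translation; so any two elements of G are equal or one of them is ε, and G is abelian.
      inverted∈U⇒trivial : ∀ {σ} → U σ → InvertedBiTranslation σ → Trivial
      inverted∈U⇒trivial uσ s g = central⇒ε (commutes g)
        where
        τ : Fin n → Sym
        τ = V.elementTo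

        biTranslation⇒≡ε : ∀ g → BiTranslation (τ g) → g ≡ ε
        biTranslation⇒≡ε g t =
          trans (sym (V.elementTo-ε g)) (inverted∈U⇒biTranslation∈V≈id uσ s (V.elementTo-∈ g) t ε)

        inverted⇒≡ : ∀ g h → InvertedBiTranslation (τ g) → InvertedBiTranslation (τ h) → g ≡ h
        inverted⇒≡ g h sg sh = begin
          g                                 ≡⟨ inverted∈U⇒biTranslation∈V≈id uσ s quotient∈V quotient g ⟨
          τ h ⟨$⟩ʳ (τ g ⟨$⟩ˡ g)              ≡⟨ cong (τ h ⟨$⟩ʳ_) τg⁻¹g≡ε ⟩
          τ h ⟨$⟩ʳ ε                         ≡⟨ V.elementTo-ε h ⟩
          h                                 ∎
          where
          τg⁻¹g≡ε : τ g ⟨$⟩ˡ g ≡ ε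
          τg⁻¹g≡ε = trans (cong (τ g ⟨$⟩ˡ_) (sym (V.elementTo-ε g))) (inverseˡ (τ g))
          quotient∈V : V (flip (τ g) ∘ₚ τ h)
          quotient∈V = V.∘-closed (V.flip-closed (V.elementTo-∈ g)) (V.elementTo-∈ h)
          quotient : BiTranslation (flip (τ g) ∘ₚ τ h)
          quotient = inverted-∘ₚ (inverted-flip sg) sh

        commutes : ∀ g h → g ∙ h ≡ h ∙ g
        commutes g h with Γ-normalForm (V⊆Γ _ (V.elementTo-∈ g)) | Γ-normalForm (V⊆Γ _ (V.elementTo-∈ h))
        ... | inj₁ tg | _      rewrite biTranslation⇒≡ε g tg = ε-central h
        ... | inj₂ _  | inj₁ th rewrite biTranslation⇒≡ε h th = sym (ε-central g)
        ... | inj₂ sg | inj₂ sh rewrite inverted⇒≡ g h sg sh = refl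

      nontrivial⇒biTranslation : ¬ Trivial → ∀ {σ} → U σ → BiTranslation σ
      nontrivial⇒biTranslation nontrivial uσ with Γ-normalForm (U⊆Γ _ uσ)
      ... | inj₁ s = s
      ... | inj₂ s = contradiction (inverted∈U⇒trivial uσ s) nontrivial

    module BiTranslationPair {U V} (gp : GoodPair U V)
        (U-biTranslation : ∀ {σ} → U σ → BiTranslation σ) (V-biTranslation : ∀ {τ} → V τ → BiTranslation τ) where
      open GoodPair gp
      open GoodPairProperties gp

      factors-commute : ∀ {σ τ} → U σ → V τ → (s : BiTranslation σ) (t : BiTranslation τ) →
        let open BiTranslation in left s ∙ left t ≡ left t ∙ left s × right t ∙ right s ≡ right s ∙ right t
      factors-commute {σ} {τ} uσ vτ s t = biTranslation-unique λ x → begin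
        left s ∙ left t ∙ x ∙ (right t ∙ right s)   ≡⟨ BiTranslation.apply (biTranslation-∘ₚ t s) x ⟨
        σ ⟨$⟩ʳ (τ ⟨$⟩ʳ x)                          ≡⟨ commute σ τ uσ vτ x ⟩
        τ ⟨$⟩ʳ (σ ⟨$⟩ʳ x)                          ≡⟨ BiTranslation.apply (biTranslation-∘ₚ s t) x ⟩
        left t ∙ left s ∙ x ∙ (right s ∙ right t)   ∎
        where open BiTranslation

      lam-left∈U : ∀ {σ} → U σ → (s : BiTranslation σ) → U (lam (BiTranslation.left s))
      lam-left∈U uσ s@(biTranslation a b _) = centralizes-V⇒∈U (lam a) λ τ vτ x →
        let t@(biTranslation c d τ≗) = V-biTranslation vτ in begin
          a ∙ (τ ⟨$⟩ʳ x)       ≡⟨ cong (a ∙_) (τ≗ x) ⟩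
          a ∙ (c ∙ x ∙ d)      ≡⟨ solve 4 (λ a c x d → a ⊕ ((c ⊕ x) ⊕ d) ⊜ ((a ⊕ c) ⊕ x) ⊕ d) refl a c x d ⟩
          a ∙ c ∙ x ∙ d        ≡⟨ cong (λ z → z ∙ x ∙ d) (proj₁ (factors-commute uσ vτ s t)) ⟩
          c ∙ a ∙ x ∙ d        ≡⟨ cong (_∙ d) (assoc c a x) ⟩
          c ∙ (a ∙ x) ∙ d      ≡⟨ τ≗ (a ∙ x) ⟨
          τ ⟨$⟩ʳ (a ∙ x)       ∎

      rho-right⁻¹∈U : ∀ {σ} → U σ → (s : BiTranslation σ) → U (rho (BiTranslation.right s ⁻¹))
      rho-right⁻¹∈U uσ s@(biTranslation a b _) = centralizes-V⇒∈U (rho (b ⁻¹)) λ τ vτ x →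
        let t@(biTranslation c d τ≗) = V-biTranslation vτ in begin
          rho (b ⁻¹) ⟨$⟩ʳ (τ ⟨$⟩ʳ x)   ≡⟨ rho-⁻¹ b _ ⟩
          (τ ⟨$⟩ʳ x) ∙ b               ≡⟨ cong (_∙ b) (τ≗ x) ⟩
          c ∙ x ∙ d ∙ b                ≡⟨ assoc (c ∙ x) d b ⟩
          c ∙ x ∙ (d ∙ b)              ≡⟨ cong (c ∙ x ∙_) (proj₂ (factors-commute uσ vτ s t)) ⟩
          c ∙ x ∙ (b ∙ d)              ≡⟨ solve 4 (λ c x b d → (c ⊕ x) ⊕ (b ⊕ d) ⊜ (c ⊕ (x ⊕ b)) ⊕ d)
                                                  refl c x b d ⟩
          c ∙ (x ∙ b) ∙ d              ≡⟨ τ≗ (x ∙ b) ⟨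
          τ ⟨$⟩ʳ (x ∙ b)               ≡⟨ cong (τ ⟨$⟩ʳ_) (rho-⁻¹ b x) ⟨
          τ ⟨$⟩ʳ (rho (b ⁻¹) ⟨$⟩ʳ x)   ∎

      factorization : ∀ g → ∃₂ λ a b → a ∈ U.lamPart × b ∈ U.rhoPart × g ≡ a ∙ b ⁻¹
      factorization g =
        left , right ⁻¹ , U.∈-preimage⁺ (lam-left∈U uσ s) , U.∈-preimage⁺ (rho-right⁻¹∈U uσ s) , (begin
        g                   ≡⟨ U.elementTo-ε g ⟨
        σ ⟨$⟩ʳ ε            ≡⟨ apply ε ⟩
        left ∙ ε ∙ right    ≡⟨ cong (_∙ right) (identityʳ left) ⟩
        left ∙ right        ≡⟨ cong (left ∙_) (⁻¹-involutive right) ⟨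
        left ∙ right ⁻¹ ⁻¹  ∎)
        where
        σ : Sym
        σ = U.elementTo g
        uσ : U σ
        uσ = U.elementTo-∈ g
        s : BiTranslation σ
        s = U-biTranslation uσ
        open BiTranslation s

      n≤∣lamPart∣*∣rhoPart∣ : n ≤ ∣ U.lamPart ∣ * ∣ U.rhoPart ∣
      n≤∣lamPart∣*∣rhoPart∣ = covered-by-product⇒≤∣p∣*∣q∣ U.lamPart U.rhoPart (λ a b → a ∙ b ⁻¹) factorization

    module _ {U V} (gp : GoodPair U V)
        (U-biTranslation : ∀ {σ} → U σ → BiTranslation σ) (V-biTranslation : ∀ {τ} → V τ → BiTranslation τ) where
      open GoodPair gp
      open GoodPairProperties gp
      module UV = BiTranslationPair gp U-biTranslation V-biTranslation
      module VU = BiTranslationPair (swap gp) V-biTranslation U-biTranslation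

      n*n≤scores : n * n ≤ score U.lamPart * score U.rhoPart
      n*n≤scores = ℕ.≤-trans
        (ℕ.*-mono-≤ UV.n≤∣lamPart∣*∣rhoPart∣
          (ℕ.≤-trans VU.n≤∣lamPart∣*∣rhoPart∣
            (ℕ.*-mono-≤ (p⊆q⇒∣p∣≤∣q∣ V-lamPart⊆centralizer) (p⊆q⇒∣p∣≤∣q∣ V-rhoPart⊆centralizer))))
        (ℕ.≤-reflexive (ℕ.[m*n]*[o*p]≡[m*o]*[n*p] (∣ L ∣) (∣ R ∣) (∣ centralizer L ∣) (∣ centralizer R ∣)))
        where
        L R : Subset n
        L = U.lamPart
        R = U.rhoPart

      n≤score-lamPart : n ≤ score U.lamPart
      n≤score-lamPart = m*m≤n*o⇒o≤m⇒m≤n n _ _ n*n≤scores (score≤n U.rhoPart-isSubgroup)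

      n≤score-rhoPart : n ≤ score U.rhoPart
      n≤score-rhoPart = m*m≤n*o⇒o≤m⇒m≤n n _ _
        (subst (n * n ≤_) (ℕ.*-comm (score U.lamPart) _) n*n≤scores) (score≤n U.lamPart-isSubgroup)

      parts⇒sameAsLambdaRho : U.lamPart ≡ ⁅ ε ⁆ ⊎ U.lamPart ≡ ⊤ → U.rhoPart ≡ ⁅ ε ⁆ ⊎ U.rhoPart ≡ ⊤ →
                              SameAsLambdaRho U V
      parts⇒sameAsLambdaRho (inj₂ lam≡⊤) _ =
        inj₁ (lam⊆U⇒≐ λ a → U.∈-preimage⁻ (subst (a ∈_) (sym lam≡⊤) ∈⊤))
      parts⇒sameAsLambdaRho (inj₁ _) (inj₂ rho≡⊤) =
        inj₂ (rho⊆U⇒≐ λ a → U.∈-preimage⁻ (subst (a ∈_) (sym rho≡⊤) ∈⊤))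
      parts⇒sameAsLambdaRho (inj₁ lam≡⁅ε⁆) (inj₁ rho≡⁅ε⁆) = trivial⇒sameAsLambdaRho trivial U-subgroup V-subgroup
        where
        trivial : Trivial
        trivial g with UV.factorization g
        ... | a , b , a∈ , b∈ , g≡a∙b⁻¹ = begin
          g          ≡⟨ g≡a∙b⁻¹ ⟩
          a ∙ b ⁻¹   ≡⟨ cong₂ (λ x y → x ∙ y ⁻¹) (x∈⁅y⁆⇒x≡y ε (subst (a ∈_) lam≡⁅ε⁆ a∈))
                                                 (x∈⁅y⁆⇒x≡y ε (subst (b ∈_) rho≡⁅ε⁆ b∈)) ⟩
          ε ∙ ε ⁻¹   ≡⟨ x≈y⇒x∙y⁻¹≈ε refl ⟩
          ε          ∎

      biTranslations⇒sameAsLambdaRho : SameAsLambdaRho U V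
      biTranslations⇒sameAsLambdaRho = parts⇒sameAsLambdaRho
        (n≤score⇒trivial⊎total U.lamPart-isSubgroup n≤score-lamPart)
        (n≤score⇒trivial⊎total U.rhoPart-isSubgroup n≤score-rhoPart)

    uniqueness : ∀ U V → GoodPair U V → SameAsLambdaRho U V
    uniqueness U V gp with all? (_≟ ε)
    ... | yes trivial   = trivial⇒sameAsLambdaRho trivial (GoodPair.U-subgroup gp) (GoodPair.V-subgroup gp)
    ... | no nontrivial = biTranslations⇒sameAsLambdaRho gp (nontrivial⇒biTranslation gp nontrivial)
                                                             (nontrivial⇒biTranslation (swap gp) nontrivial)

lemma2p5 : (n : ℕ) (G : FinGroup n) →
    Notions.MaximizersTrivial G →
    Notions.GoodPair G (Notions.λG G) (Notions.ρG G)
    × (∀ U V → Notions.GoodPair G U V → Notions.SameAsLambdaRho G U V)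
lemma2p5 n G maximizersTrivial = λG-ρG-goodPair G , uniqueness G maximizersTrivial
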